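{- Let $\mathcal{M}$ be a countable Scott set coded by $M = \bigoplus_i X_i$ and let $C \subseteq \omega^2$. If $\mathcal{U}^{\mathcal{M}}_C$ is an $\mathcal{M}$-minimal largeness class, then $\mathcal{U}^{\mathcal{M}}_C$ is partition regular.
   Context: Subsets of $\omega$ are identified with elements of $2^\omega$. A largeness class is a non-empty $\mathcal{A} \subseteq 2^\omega$ which is closed upward under $\subseteq$ and such that for every $k$ and every $Y_0 \cup \dots \cup Y_{k-1} \supseteq \omega$, some $Y_j \in \mathcal{A}$. A partition regular class is a largeness class $\mathcal{L}$ such that for every $X \in \mathcal{L}$ and every $Y_0 \cup \dots \cup Y_{k-1} \supseteq X$, some $Y_j \in \mathcal{L}$. A Scott set is a collection of sets closed downward under Turing reducibility and under join, such that every infinite binary tree in it has an infinite path in it; $\mathcal{M}$ is countable coded by $M$ if $\mathcal{M} = \{X_0, X_1, \dots\}$ and $M = \bigoplus_i X_i$. Fix an effective enumeration $\mathcal{U}^Z_0, \mathcal{U}^Z_1, \dots$ (uniform in $Z$) of all $\Sigma^0_1(Z)$ classes upward-closed under $\subseteq$. For $C \subseteq \omega^2$, $\mathcal{U}^{\mathcal{M}}_C = \bigcap_{\langle e,i \rangle \in C} \mathcal{U}^{X_i}_e$. A class $\mathcal{A}$ is $\mathcal{M}$-minimal if for every $X \in \mathcal{M}$ and $e \in \omega$, either $\mathcal{A} \subseteq \mathcal{U}^X_e$ or $\mathcal{A} \cap \mathcal{U}^X_e$ is not a largeness class. -}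

module Defs where

open import Data.Nat using (ℕ; zero; suc; _≤_; _<_)
open import Data.Bool using (Bool; true; false)
open import Data.Fin using (Fin)
open import Data.Vec using (Vec; []; _∷_; lookup)
open import Data.List using (List; []; _∷_; _++_; length)
open import Data.Product using (Σ; _×_; ∃)
open import Data.Sum using (_⊎_)
open import Relation.Binary.PropositionalEquality using (_≡_)
open import Relation.Nullary using (¬_)

Set2ω : Set
Set2ω = ℕ → Bool

_⊆_ : Set2ω → Set2ω → Set
X ⊆ Y = ∀ n → X n ≡ true → Y n ≡ true

_≐_ : Set2ω → Set2ω → Set
X ≐ Y = ∀ n → X n ≡ Y n

Class : Set₁
Class = Set2ω → Set

-- effective join  (A ⊕ B)(2n) = A n , (A ⊕ B)(2n+1) = B n
_⊕_ : Set2ω → Set2ω → Set2ω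
(A ⊕ B) zero = A zero
(A ⊕ B) (suc zero) = B zero
(A ⊕ B) (suc (suc n)) = ((λ k → A (suc k)) ⊕ (λ k → B (suc k))) n

data PR : ℕ → Set where
  zer  : ∀ {n} → PR n
  succ : PR 1
  proj : ∀ {n} → Fin n → PR n
  orc  : PR 1
  comp : ∀ {m n} → PR m → Vec (PR n) m → PR n
  prec : ∀ {n} → PR n → PR (suc (suc n)) → PR (suc n)
  mu   : ∀ {n} → PR (suc n) → PR n

bit : Bool → ℕ
bit true = 1
bit false = 0

mutual
  data Eval (Z : Set2ω) : ∀ {n} → PR n → Vec ℕ n → ℕ → Set where
    ezer   : ∀ {n} {xs : Vec ℕ n} → Eval Z zer xs 0
    esucc  : ∀ {x} → Eval Z succ (x ∷ []) (suc x)
    eproj  : ∀ {n} {i : Fin n} {xs} → Eval Z (proj i) xs (lookup xs i)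
    eorc   : ∀ {x} → Eval Z orc (x ∷ []) (bit (Z x))
    ecomp  : ∀ {m n} {f : PR m} {gs : Vec (PR n) m} {xs ys v} →
             EvalAll Z gs xs ys → Eval Z f ys v → Eval Z (comp f gs) xs v
    eprec0 : ∀ {n} {g : PR n} {h xs v} → Eval Z g xs v → Eval Z (prec g h) (0 ∷ xs) v
    eprecS : ∀ {n} {g : PR n} {h xs y w v} →
             Eval Z (prec g h) (y ∷ xs) w → Eval Z h (y ∷ w ∷ xs) v →
             Eval Z (prec g h) (suc y ∷ xs) v
    emu    : ∀ {n} {f : PR (suc n)} {xs y} →
             Eval Z f (y ∷ xs) 0 →
             (∀ z → z < y → Σ ℕ λ w → Eval Z f (z ∷ xs) (suc w)) →
             Eval Z (mu f) xs y

  data EvalAll (Z : Set2ω) : ∀ {m n} → Vec (PR n) m → Vec ℕ n → Vec ℕ m → Set where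
    []  : ∀ {n} {xs : Vec ℕ n} → EvalAll Z [] xs []
    _∷_ : ∀ {m n} {g : PR n} {gs : Vec (PR n) m} {xs y ys} →
          Eval Z g xs y → EvalAll Z gs xs ys → EvalAll Z (g ∷ gs) xs (y ∷ ys)

_≤T_ : Set2ω → Set2ω → Set
Y ≤T Z = Σ (PR 1) λ e → ∀ n → Eval Z e (n ∷ []) (bit (Y n))

-- Canonical finite sets D_n = { i : bit i of n is 1 }

half : ℕ → ℕ
half zero = zero
half (suc zero) = zero
half (suc (suc n)) = suc (half n)

odd : ℕ → Bool
odd zero = false
odd (suc zero) = true
odd (suc (suc n)) = odd n

D : ℕ → Set2ω
D n zero = odd n
D n (suc i) = D (half n) i

-- The effective enumeration of upward-closed Σ⁰₁(Z) classes:
-- U^Z_e = { Y : ∃ n ∈ W^Z_e, D_n ⊆ Y },  W^Z_e = dom(φ^Z_e).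
-- Indices e range over the (countable, effectively enumerable) type PR 1.

W : Set2ω → PR 1 → ℕ → Set
W Z e n = Σ ℕ λ v → Eval Z e (n ∷ []) v

U : Set2ω → PR 1 → Class
U Z e Y = Σ ℕ λ n → W Z e n × (D n ⊆ Y)

UMC : (ℕ → Set2ω) → (PR 1 → ℕ → Set) → Class
UMC X C Y = ∀ e i → C e i → U (X i) e Y

Covers : ∀ {k} → (Fin k → Set2ω) → Set2ω → Set
Covers {k} Ys X = ∀ n → X n ≡ true → Σ (Fin k) λ j → Ys j n ≡ true

ω : Set2ω
ω _ = true

IsLargeness : Class → Set
IsLargeness A =
  (Σ Set2ω A) ×
  (∀ X Y → A X → X ⊆ Y → A Y) ×
  (∀ k (Ys : Fin k → Set2ω) → Covers Ys ω → Σ (Fin k) λ j → A (Ys j))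

IsPartitionRegular : Class → Set
IsPartitionRegular L =
  IsLargeness L ×
  (∀ X → L X → ∀ k (Ys : Fin k → Set2ω) → Covers Ys X → Σ (Fin k) λ j → L (Ys j))

-- Countable Scott sets coded by M = ⊕_i X_i  (given as the sequence X)

code : List Bool → ℕ
code [] = 0
code (false ∷ s) = suc (2 Data.Nat.* code s)
code (true ∷ s) = suc (suc (2 Data.Nat.* code s))

take : ℕ → Set2ω → List Bool
take zero P = []
take (suc n) P = P zero ∷ take n (λ k → P (suc k))

IsTree : Set2ω → Set
IsTree T = ∀ σ τ → T (code (σ ++ τ)) ≡ true → T (code σ) ≡ true

Infinite : Set2ω → Set
Infinite T = ∀ m → Σ ℕ λ n → m ≤ n × T n ≡ true

IsPath : Set2ω → Set2ω → Set
IsPath P T = ∀ n → T (code (take n P)) ≡ true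

InColl : (ℕ → Set2ω) → Set2ω → Set
InColl X Y = Σ ℕ λ j → X j ≐ Y

IsScottSet : (ℕ → Set2ω) → Set
IsScottSet X =
  (∀ Y i → Y ≤T X i → InColl X Y) ×
  (∀ i j → InColl X (X i ⊕ X j)) ×
  (∀ i → IsTree (X i) → Infinite (X i) →
     Σ Set2ω λ P → IsPath P (X i) × InColl X P)

IsMinimal : (ℕ → Set2ω) → Class → Set
IsMinimal X A = ∀ i e →
  (∀ Y → A Y → U (X i) e Y) ⊎ (¬ IsLargeness (λ Y → A Y × U (X i) e Y))

-- Let 𝒜 = 𝒰^𝓜_C, S ∈ 𝒜 and S ⊆ Y₀ ∪ Y₁ with Y₀, Y₁ ∉ 𝒜, so that Yⱼ ∉ 𝒰ⱼ = 𝒰^{X_{iⱼ}}_{eⱼ} for some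
-- ⟨e₀,i₀⟩, ⟨e₁,i₁⟩ ∈ C. The class 𝒱 of sets having no splitting V ⊆ Z₀ ∪ Z₁ with Z₀ ∉ 𝒰₀ and Z₁ ∉ 𝒰₁ is
-- upward closed and, by compactness, Σ⁰₁ in X_{i₀} ⊕ X_{i₁} ∈ 𝓜. Every set outside 𝒱 splits into two
-- sets outside 𝒜, so 𝒜 ∩ 𝒱 is again a largeness class and 𝓜-minimality forces 𝒜 ⊆ 𝒱, contradicting
-- S ∈ 𝒜 ∖ 𝒱. Covers by k sets reduce to this case by induction; members of 𝒜 are nonempty since
-- otherwise 𝒜 would be everything and 𝒜 ∩ {Y : 0 ∈ Y} would contradict minimality.
-- That 𝒱 is Σ⁰₁ is shown by exhibiting its index: a step-bounded interpreter for the programs e₀, e₁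
-- is compiled into a program with oracle X_{i₀} ⊕ X_{i₁} searching for a finite set D n ⊆ V all of
-- whose splittings are caught by 𝒰₀ or 𝒰₁ at a finite stage.

module Submission where

open import Defs
open import Level using (0ℓ)
open import Function using (_∘_)
open import Data.Nat using (ℕ; zero; suc; _+_; _*_; _^_; _≤_; _<_; z≤n; s≤s; s≤s⁻¹; pred; _⊔_)
open import Data.Nat.Properties
open import Data.Bool using (Bool; true; false; _∨_)
open import Data.Bool.Properties using (∨-zeroʳ)
open import Data.Fin using (Fin; zero; suc; _↑ʳ_; splitAt; join)
open import Data.Fin.Properties using (splitAt-join)
open import Data.Vec using (Vec; []; _∷_; head; tail; lookup; tabulate; map; drop)
open import Data.Vec.Properties using (tabulate∘lookup)
open import Data.Product using (Σ; _×_; _,_; proj₁; proj₂)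
open import Data.Sum using (_⊎_; inj₁; inj₂; [_,_]′) renaming (map to ⊎-map)
open import Data.Empty using (⊥; ⊥-elim)
open import Relation.Binary.PropositionalEquality
open import Relation.Binary.Definitions using (tri<; tri≈; tri>)
open import Relation.Nullary using (¬_; yes; no)
open import Axiom.ExcludedMiddle using (ExcludedMiddle)
open import Axiom.DoubleNegationElimination using (em⇒dne)

-- Primitive recursive expressions relative to an oracle

primrec : ℕ → (ℕ → ℕ → ℕ) → ℕ → ℕ
primrec a f zero    = a
primrec a f (suc i) = f i (primrec a f i)

primrec-cong : ∀ {a b} {f g : ℕ → ℕ → ℕ} {n m} → a ≡ b → (∀ i w → f i w ≡ g i w) → n ≡ m →
               primrec a f n ≡ primrec b g m
primrec-cong         {n = zero}  refl f≗g refl = refl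
primrec-cong {f = f} {n = suc n} refl f≗g refl = trans (cong (f n) (primrec-cong {n = n} refl f≗g refl)) (f≗g n _)

infix 5 if⁺_then_else_
if⁺_then_else_ : ℕ → ℕ → ℕ → ℕ
if⁺ zero  then x else y = y
if⁺ suc _ then x else y = x

prod< : ℕ → (ℕ → ℕ) → ℕ
prod< b f = primrec 1 (λ i w → w * f i) b

sum< : ℕ → (ℕ → ℕ) → ℕ
sum< b f = primrec 0 (λ i w → w + f i) b

primrec-const : ∀ x y c → primrec y (λ _ _ → x) c ≡ if⁺ c then x else y
primrec-const x y zero    = refl
primrec-const x y (suc c) = refl

primrec-pred : ∀ n → primrec 0 (λ i _ → i) n ≡ pred n
primrec-pred zero    = refl
primrec-pred (suc n) = refl

primrec-+ : ∀ a b → primrec a (λ _ w → suc w) b ≡ b + a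
primrec-+ a zero    = refl
primrec-+ a (suc b) = cong suc (primrec-+ a b)

primrec-* : ∀ a b → primrec 0 (λ _ w → a + w) b ≡ b * a
primrec-* a zero    = refl
primrec-* a (suc b) = cong (a +_) (primrec-* a b)

primrec-^ : ∀ n → primrec 1 (λ _ w → w + w) n ≡ 2 ^ n
primrec-^ zero    = refl
primrec-^ (suc n) = trans (cong (λ w → w + w) (primrec-^ n)) (cong (2 ^ n +_) (sym (+-identityʳ (2 ^ n))))

bit-odd-suc : ∀ n → bit (odd (suc n)) ≡ if⁺ bit (odd n) then 0 else 1
bit-odd-suc zero          = refl
bit-odd-suc (suc zero)    = refl
bit-odd-suc (suc (suc n)) = bit-odd-suc n

primrec-odd : ∀ n → primrec 0 (λ _ w → if⁺ w then 0 else 1) n ≡ bit (odd n)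
primrec-odd zero    = refl
primrec-odd (suc n) = trans (cong (if⁺_then 0 else 1) (primrec-odd n)) (sym (bit-odd-suc n))

half-suc : ∀ n → half (suc n) ≡ half n + bit (odd n)
half-suc zero          = refl
half-suc (suc zero)    = refl
half-suc (suc (suc n)) = cong suc (half-suc n)

primrec-half : ∀ n → primrec 0 (λ i w → w + bit (odd i)) n ≡ half n
primrec-half zero    = refl
primrec-half (suc n) = trans (cong (_+ bit (odd n)) (primrec-half n)) (sym (half-suc n))

half-iterate-comm : ∀ m i → primrec (half m) (λ _ → half) i ≡ half (primrec m (λ _ → half) i)
half-iterate-comm m zero    = refl
half-iterate-comm m (suc i) = cong half (half-iterate-comm m i)

odd-half-iterate : ∀ m i → odd (primrec m (λ _ → half) i) ≡ D m i
odd-half-iterate m zero    = refl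
odd-half-iterate m (suc i) = trans (cong odd (sym (half-iterate-comm m i))) (odd-half-iterate (half m) i)

data Expr : ℕ → Set where
  `var    : ∀ {n} → Fin n → Expr n
  `zero   : ∀ {n} → Expr n
  `suc    : ∀ {n} → Expr n → Expr n
  `oracle : ∀ {n} → Expr n → Expr n
  `rec    : ∀ {n} → Expr n → Expr (2 + n) → Expr n → Expr n
  _`∘_    : ∀ {m n} → Expr m → Vec (Expr n) m → Expr n

mutual
  compile : ∀ {n} → Expr n → PR n
  compile (`var i)     = proj i
  compile `zero        = zer
  compile (`suc e)     = comp succ (compile e ∷ [])
  compile (`oracle e)  = comp orc (compile e ∷ [])
  compile (`rec b s y) = comp (prec (compile b) (compile s)) (compile y ∷ tabulate proj)
  compile (e `∘ es)    = comp (compile e) (compile* es)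

  compile* : ∀ {n m} → Vec (Expr n) m → Vec (PR n) m
  compile* []       = []
  compile* (e ∷ es) = compile e ∷ compile* es

module Semantics (Z : Set2ω) where

  mutual
    ⟦_⟧ : ∀ {n} → Expr n → Vec ℕ n → ℕ
    ⟦ `var i ⟧     ρ = lookup ρ i
    ⟦ `zero ⟧      ρ = 0
    ⟦ `suc e ⟧     ρ = suc (⟦ e ⟧ ρ)
    ⟦ `oracle e ⟧  ρ = bit (Z (⟦ e ⟧ ρ))
    ⟦ `rec b s y ⟧ ρ = primrec (⟦ b ⟧ ρ) (λ i w → ⟦ s ⟧ (i ∷ w ∷ ρ)) (⟦ y ⟧ ρ)
    ⟦ e `∘ es ⟧    ρ = ⟦ e ⟧ (⟦ es ⟧* ρ)

    ⟦_⟧* : ∀ {n m} → Vec (Expr n) m → Vec ℕ n → Vec ℕ m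
    ⟦ [] ⟧*     ρ = []
    ⟦ e ∷ es ⟧* ρ = ⟦ e ⟧ ρ ∷ ⟦ es ⟧* ρ

  ⟦vars⟧ : ∀ {n m} (g : Fin m → Fin n) (ρ : Vec ℕ n) →
           ⟦ tabulate (`var ∘ g) ⟧* ρ ≡ tabulate (lookup ρ ∘ g)
  ⟦vars⟧ {m = zero}  g ρ = refl
  ⟦vars⟧ {m = suc m} g ρ = cong (lookup ρ (g zero) ∷_) (⟦vars⟧ (g ∘ suc) ρ)

  eval-projections : ∀ {n m} (g : Fin m → Fin n) (ρ : Vec ℕ n) →
                     EvalAll Z (tabulate (proj ∘ g)) ρ (tabulate (lookup ρ ∘ g))
  eval-projections {m = zero}  g ρ = []
  eval-projections {m = suc m} g ρ = eproj ∷ eval-projections (g ∘ suc) ρ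

  eval-identity : ∀ {n} (ρ : Vec ℕ n) → EvalAll Z (tabulate proj) ρ ρ
  eval-identity ρ = subst (EvalAll Z (tabulate proj) ρ) (tabulate∘lookup ρ) (eval-projections (λ i → i) ρ)

  mutual
    compile-correct : ∀ {n} (e : Expr n) ρ → Eval Z (compile e) ρ (⟦ e ⟧ ρ)
    compile-correct (`var i)     ρ = eproj
    compile-correct `zero        ρ = ezer
    compile-correct (`suc e)     ρ = ecomp (compile-correct e ρ ∷ []) esucc
    compile-correct (`oracle e)  ρ = ecomp (compile-correct e ρ ∷ []) eorc
    compile-correct (`rec b s y) ρ = ecomp (compile-correct y ρ ∷ eval-identity ρ) (recursion (⟦ y ⟧ ρ))
      where
      recursion : ∀ k → Eval Z (prec (compile b) (compile s)) (k ∷ ρ)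
                                (primrec (⟦ b ⟧ ρ) (λ i w → ⟦ s ⟧ (i ∷ w ∷ ρ)) k)
      recursion zero    = eprec0 (compile-correct b ρ)
      recursion (suc k) = eprecS (recursion k) (compile-correct s _)
    compile-correct (e `∘ es)    ρ = ecomp (compile*-correct es ρ) (compile-correct e _)

    compile*-correct : ∀ {n m} (es : Vec (Expr n) m) ρ → EvalAll Z (compile* es) ρ (⟦ es ⟧* ρ)
    compile*-correct []       ρ = []
    compile*-correct (e ∷ es) ρ = compile-correct e ρ ∷ compile*-correct es ρ

  mutual
    Eval-functional : ∀ {n} {f : PR n} {xs v w} → Eval Z f xs v → Eval Z f xs w → v ≡ w
    Eval-functional ezer  ezer  = refl
    Eval-functional esucc esucc = refl
    Eval-functional eproj eproj = refl
    Eval-functional eorc  eorc  = refl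
    Eval-functional (ecomp p q) (ecomp p′ q′) with EvalAll-functional p p′
    ... | refl = Eval-functional q q′
    Eval-functional (eprec0 p) (eprec0 p′) = Eval-functional p p′
    Eval-functional (eprecS p q) (eprecS p′ q′) with Eval-functional p p′
    ... | refl = Eval-functional q q′
    Eval-functional (emu {y = y} p below) (emu {y = y′} p′ below′) with <-cmp y y′
    ... | tri≈ _ refl _ = refl
    ... | tri< y<y′ _ _ = Eval-0-suc-absurd p (below′ y y<y′)
    ... | tri> _ _ y′<y = Eval-0-suc-absurd p′ (below y′ y′<y)

    EvalAll-functional : ∀ {m n} {gs : Vec (PR n) m} {xs ys ys′} →
                         EvalAll Z gs xs ys → EvalAll Z gs xs ys′ → ys ≡ ys′
    EvalAll-functional []       []         = refl
    EvalAll-functional (p ∷ ps) (p′ ∷ ps′) = cong₂ _∷_ (Eval-functional p p′) (EvalAll-functional ps ps′)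

    Eval-0-suc-absurd : ∀ {n} {f : PR n} {xs} {A : Set} → Eval Z f xs 0 → Σ ℕ (λ w → Eval Z f xs (suc w)) → A
    Eval-0-suc-absurd p (w , q) with Eval-functional p q
    ... | ()

  Computable : ∀ n → (Vec ℕ n → ℕ) → Set
  Computable n f = Σ (Expr n) λ e → ∀ ρ → ⟦ e ⟧ ρ ≡ f ρ

  Computable* : ∀ n m → (Vec ℕ n → Vec ℕ m) → Set
  Computable* n m f = Σ (Vec (Expr n) m) λ es → ∀ ρ → ⟦ es ⟧* ρ ≡ f ρ

  castᶜ : ∀ {n f g} → (∀ ρ → f ρ ≡ g ρ) → Computable n f → Computable n g
  castᶜ f≗g (e , e≗f) = e , λ ρ → trans (e≗f ρ) (f≗g ρ)

  exactᶜ : ∀ {n} (e : Expr n) → Computable n ⟦ e ⟧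
  exactᶜ e = e , λ _ → refl

  varᶜ : ∀ {n} (i : Fin n) → Computable n (λ ρ → lookup ρ i)
  varᶜ i = exactᶜ (`var i)

  zeroᶜ : ∀ {n} → Computable n (λ _ → 0)
  zeroᶜ = exactᶜ `zero

  sucᶜ : ∀ {n f} → Computable n f → Computable n (suc ∘ f)
  sucᶜ (e , e≗f) = `suc e , λ ρ → cong suc (e≗f ρ)

  oracleᶜ : ∀ {n f} → Computable n f → Computable n (λ ρ → bit (Z (f ρ)))
  oracleᶜ (e , e≗f) = `oracle e , λ ρ → cong (bit ∘ Z) (e≗f ρ)

  recᶜ : ∀ {n b s y} → Computable n b → Computable (2 + n) s → Computable n y →
         Computable n (λ ρ → primrec (b ρ) (λ i w → s (i ∷ w ∷ ρ)) (y ρ))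
  recᶜ (b , b≗) (s , s≗) (y , y≗) =
    `rec b s y , λ ρ → primrec-cong (b≗ ρ) (λ i w → s≗ (i ∷ w ∷ ρ)) (y≗ ρ)

  []ᶜ : ∀ {n} → Computable* n 0 (λ _ → [])
  []ᶜ = [] , λ _ → refl

  infixr 5 _∷ᶜ_
  _∷ᶜ_ : ∀ {n m f fs} → Computable n f → Computable* n m fs → Computable* n (suc m) (λ ρ → f ρ ∷ fs ρ)
  (e , e≗) ∷ᶜ (es , es≗) = e ∷ es , λ ρ → cong₂ _∷_ (e≗ ρ) (es≗ ρ)

  dropᶜ : ∀ k {n} → Computable* (k + n) n (drop k)
  dropᶜ k = tabulate (`var ∘ (k ↑ʳ_)) , λ ρ → trans (⟦vars⟧ (k ↑ʳ_) ρ) (lookup-↑ʳ k ρ)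
    where
    lookup-↑ʳ : ∀ k {n} (ρ : Vec ℕ (k + n)) → tabulate (lookup ρ ∘ (k ↑ʳ_)) ≡ drop k ρ
    lookup-↑ʳ zero    ρ       = tabulate∘lookup ρ
    lookup-↑ʳ (suc k) (x ∷ ρ) = lookup-↑ʳ k ρ

  infixr 9 _∘ᶜ_
  _∘ᶜ_ : ∀ {n m f gs} → Computable m f → Computable* n m gs → Computable n (f ∘ gs)
  (e , e≗) ∘ᶜ (es , es≗) = e `∘ es , λ ρ → trans (cong ⟦ e ⟧ (es≗ ρ)) (e≗ _)

  v₀ᶜ : ∀ {n} → Computable (1 + n) (λ ρ → lookup ρ zero)
  v₀ᶜ = varᶜ zero

  v₁ᶜ : ∀ {n} → Computable (2 + n) (λ ρ → lookup ρ (suc zero))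
  v₁ᶜ = varᶜ (suc zero)

  v₂ᶜ : ∀ {n} → Computable (3 + n) (λ ρ → lookup ρ (suc (suc zero)))
  v₂ᶜ = varᶜ (suc (suc zero))

  v₃ᶜ : ∀ {n} → Computable (4 + n) (λ ρ → lookup ρ (suc (suc (suc zero))))
  v₃ᶜ = varᶜ (suc (suc (suc zero)))

  oneᶜ : ∀ {n} → Computable n (λ _ → 1)
  oneᶜ = sucᶜ zeroᶜ

  if⁺ᶜ : ∀ {n c x y} → Computable n c → Computable n x → Computable n y →
         Computable n (λ ρ → if⁺ c ρ then x ρ else y ρ)
  if⁺ᶜ {c = c} {x} {y} c′ x′ y′ = castᶜ (λ ρ → primrec-const (x ρ) (y ρ) (c ρ)) (recᶜ y′ (x′ ∘ᶜ dropᶜ 2) c′)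

  predᶜ : ∀ {n f} → Computable n f → Computable n (pred ∘ f)
  predᶜ {f = f} f′ = castᶜ (primrec-pred ∘ f) (recᶜ zeroᶜ v₀ᶜ f′)

  infixl 6 _+ᶜ_
  _+ᶜ_ : ∀ {n f g} → Computable n f → Computable n g → Computable n (λ ρ → f ρ + g ρ)
  _+ᶜ_ {f = f} {g} f′ g′ = castᶜ (λ ρ → primrec-+ (g ρ) (f ρ)) (recᶜ g′ (sucᶜ v₁ᶜ) f′)

  infixl 7 _*ᶜ_
  _*ᶜ_ : ∀ {n f g} → Computable n f → Computable n g → Computable n (λ ρ → f ρ * g ρ)
  _*ᶜ_ {f = f} {g} f′ g′ = castᶜ (λ ρ → primrec-* (g ρ) (f ρ)) (recᶜ zeroᶜ ((g′ ∘ᶜ dropᶜ 2) +ᶜ v₁ᶜ) f′)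

  prodᶜ : ∀ {n b f} → Computable n b → Computable (suc n) f →
          Computable n (λ ρ → prod< (b ρ) (λ i → f (i ∷ ρ)))
  prodᶜ b f = recᶜ oneᶜ (v₁ᶜ *ᶜ (f ∘ᶜ (v₀ᶜ ∷ᶜ dropᶜ 2))) b

  sumᶜ : ∀ {n b f} → Computable n b → Computable (suc n) f →
         Computable n (λ ρ → sum< (b ρ) (λ i → f (i ∷ ρ)))
  sumᶜ b f = recᶜ zeroᶜ (v₁ᶜ +ᶜ (f ∘ᶜ (v₀ᶜ ∷ᶜ dropᶜ 2))) b

  oddᶜ : ∀ {n f} → Computable n f → Computable n (λ ρ → bit (odd (f ρ)))
  oddᶜ {f = f} f′ = castᶜ (primrec-odd ∘ f) (recᶜ zeroᶜ (if⁺ᶜ v₁ᶜ zeroᶜ oneᶜ) f′)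

  halfᶜ : ∀ {n f} → Computable n f → Computable n (half ∘ f)
  halfᶜ {f = f} f′ = castᶜ (primrec-half ∘ f) (recᶜ zeroᶜ (v₁ᶜ +ᶜ oddᶜ v₀ᶜ) f′)

  memberᶜ : ∀ {n i m} → Computable n i → Computable n m → Computable n (λ ρ → bit (D (m ρ) (i ρ)))
  memberᶜ {i = i} {m} i′ m′ = castᶜ (λ ρ → cong bit (odd-half-iterate (m ρ) (i ρ))) (oddᶜ (recᶜ m′ (halfᶜ v₁ᶜ) i′))

  pow2ᶜ : ∀ {n f} → Computable n f → Computable n (λ ρ → 2 ^ f ρ)
  pow2ᶜ {f = f} f′ = castᶜ (primrec-^ ∘ f) (recᶜ oneᶜ (v₁ᶜ +ᶜ v₁ᶜ) f′)

-- A step-bounded interpreter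

Eventually : (ℕ → Set) → Set
Eventually P = Σ ℕ λ t₀ → ∀ t → t₀ ≤ t → P t

eventually-× : ∀ {P Q} → Eventually P → Eventually Q → Eventually (λ t → P t × Q t)
eventually-× (t₁ , p) (t₂ , q) = t₁ ⊔ t₂ , λ t le → p t (≤-trans (m≤m⊔n t₁ t₂) le) , q t (≤-trans (m≤n⊔m t₁ t₂) le)

eventually-≥ : ∀ n → Eventually (n ≤_)
eventually-≥ n = n , λ _ le → le

eventually-∀< : ∀ {P : ℕ → ℕ → Set} y → (∀ z → z < y → Eventually (P z)) →
                Eventually (λ t → ∀ z → z < y → P z t)
eventually-∀< zero    ev = 0 , λ _ _ _ ()
eventually-∀< {P} (suc y) ev with eventually-× (eventually-∀< y (λ z lt → ev z (m<n⇒m<1+n lt))) (ev y ≤-refl)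
... | t₀ , p = t₀ , λ t le z lt → split z lt (p t le)
  where
  split : ∀ {t} z → z < suc y → (∀ z → z < y → P z t) × P y t → P z t
  split z lt (below , at) with m<1+n⇒m<n∨m≡n lt
  ... | inj₁ z<y  = below z z<y
  ... | inj₂ refl = at

allHalted : ∀ {m} → Vec ℕ m → ℕ
allHalted []       = 1
allHalted (r ∷ rs) = if⁺ r then allHalted rs else 0

-- The accumulator of a μ-search is 0 while searching, 1 once some candidate failed to halt,
-- and 2 + y once y is found.
searchStep : ℕ → ℕ → ℕ → ℕ
searchStep a r c = if⁺ a then a else (if⁺ r then (if⁺ pred r then 0 else 2 + c) else 1)

search : (ℕ → ℕ) → ℕ → ℕ
search r c = primrec 0 (λ c a → searchStep a (r c) c) c

search-running : ∀ r c → search r c ≡ 0 → ∀ z → z < c → Σ ℕ λ w → r z ≡ 2 + w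
search-running r (suc c) eq z lt with search r c in e₁
search-running r (suc c) () z lt | suc a
... | zero with r c in e₂
search-running r (suc c) () z lt | zero | zero
search-running r (suc c) () z lt | zero | suc zero
... | suc (suc w) with m<1+n⇒m<n∨m≡n lt
... | inj₁ z<c  = search-running r c e₁ z z<c
... | inj₂ refl = w , e₂

search-found : ∀ r c y → search r c ≡ 2 + y → r y ≡ 1 × (∀ z → z < y → Σ ℕ λ w → r z ≡ 2 + w)
search-found r (suc c) y eq with search r c in e₁
... | suc a = search-found r c y (trans e₁ eq)
... | zero with r c in e₂
search-found r (suc c) y ()   | zero | zero
search-found r (suc c) .c refl | zero | suc zero = e₂ , search-running r c e₁
search-found r (suc c) y ()   | zero | suc (suc w)

search-continues : ∀ r c → (∀ z → z < c → Σ ℕ λ w → r z ≡ 2 + w) → search r c ≡ 0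
search-continues r zero    below = refl
search-continues r (suc c) below
  rewrite search-continues r c (λ z lt → below z (m<n⇒m<1+n lt)) | proj₂ (below c ≤-refl) = refl

search-finds : ∀ r y → (∀ z → z < y → Σ ℕ λ w → r z ≡ 2 + w) → r y ≡ 1 →
               ∀ c → y < c → search r c ≡ 2 + y
search-finds r y below ry (suc c) lt with m<1+n⇒m<n∨m≡n lt
... | inj₂ refl rewrite search-continues r y below | ry = refl
... | inj₁ y<c  rewrite search-finds r y below ry c y<c = refl

-- run t f xs is 0 if f has not halted when μ-searches are cut off after t + 1 candidates,
-- and suc v if it has halted with value v.
module Interpreter (O : Set2ω) where
  mutual
    run : ∀ {n} → ℕ → PR n → Vec ℕ n → ℕ
    run t zer         xs        = 1
    run t succ        (x ∷ [])  = suc (suc x)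
    run t (proj i)    xs        = suc (lookup xs i)
    run t orc         (x ∷ [])  = suc (bit (O x))
    run t (comp f gs) xs        = if⁺ allHalted (runs t gs xs) then run t f (map pred (runs t gs xs)) else 0
    run t (prec g h)  (y ∷ xs)  = primrec (run t g xs) (λ i w → if⁺ w then run t h (i ∷ pred w ∷ xs) else 0) y
    run t (mu f)      xs        = pred (search (λ c → run t f (c ∷ xs)) (suc t))

    runs : ∀ {m n} → ℕ → Vec (PR n) m → Vec ℕ n → Vec ℕ m
    runs t []       xs = []
    runs t (g ∷ gs) xs = run t g xs ∷ runs t gs xs

  if⁺-halted : ∀ a x {v} → if⁺ a then x else 0 ≡ suc v → (Σ ℕ λ k → a ≡ suc k) × x ≡ suc v
  if⁺-halted (suc k) x eq = (k , refl) , eq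

  mutual
    run-sound : ∀ {n} (f : PR n) t xs v → run t f xs ≡ suc v → Eval O f xs v
    run-sound zer      t xs       .0               refl = ezer
    run-sound succ     t (x ∷ []) .(suc x)         refl = esucc
    run-sound (proj i) t xs       .(lookup xs i)   refl = eproj
    run-sound orc      t (x ∷ []) .(bit (O x))     refl = eorc
    run-sound (comp f gs) t xs v eq with if⁺-halted (allHalted (runs t gs xs)) _ eq
    ... | (k , halted) , eq′ = ecomp (runs-sound gs t xs k halted) (run-sound f t _ v eq′)
    run-sound (prec g h) t (y ∷ xs) v eq = prec-sound g h t xs y v eq
    run-sound (mu f) t xs v eq with search-found (λ c → run t f (c ∷ xs)) (suc t) v (pred≡suc eq)
      where
      pred≡suc : ∀ {a} → pred a ≡ suc v → a ≡ 2 + v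
      pred≡suc {suc a} refl = refl
    ... | at , below = emu (run-sound f t _ 0 at) (λ z lt → proj₁ (below z lt) , run-sound f t _ _ (proj₂ (below z lt)))

    prec-sound : ∀ {n} (g : PR n) h t xs y v → run t (prec g h) (y ∷ xs) ≡ suc v → Eval O (prec g h) (y ∷ xs) v
    prec-sound g h t xs zero    v eq = eprec0 (run-sound g t xs v eq)
    prec-sound g h t xs (suc y) v eq with if⁺-halted (run t (prec g h) (y ∷ xs)) _ eq
    ... | (k , halted) , eq′ =
      eprecS (prec-sound g h t xs y k halted)
             (run-sound h t _ v (trans (cong (λ a → run t h (y ∷ pred a ∷ xs)) (sym halted)) eq′))

    runs-sound : ∀ {m n} (gs : Vec (PR n) m) t xs k → allHalted (runs t gs xs) ≡ suc k →
                 EvalAll O gs xs (map pred (runs t gs xs))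
    runs-sound []       t xs k eq = []
    runs-sound (g ∷ gs) t xs k eq with run t g xs in e
    ... | suc r = run-sound g t xs r e ∷ runs-sound gs t xs k eq

  allHalted-suc : ∀ {m} (ys : Vec ℕ m) → allHalted (map suc ys) ≡ 1
  allHalted-suc []       = refl
  allHalted-suc (y ∷ ys) = allHalted-suc ys

  map-pred-suc : ∀ {m} (ys : Vec ℕ m) → map pred (map suc ys) ≡ ys
  map-pred-suc []       = refl
  map-pred-suc (y ∷ ys) = cong (y ∷_) (map-pred-suc ys)

  mutual
    run-complete : ∀ {n} {f : PR n} {xs v} → Eval O f xs v → Eventually (λ t → run t f xs ≡ suc v)
    run-complete ezer  = 0 , λ _ _ → refl
    run-complete esucc = 0 , λ _ _ → refl
    run-complete eproj = 0 , λ _ _ → refl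
    run-complete eorc  = 0 , λ _ _ → refl
    run-complete (ecomp {f = f} {gs = gs} {xs = xs} {ys = ys} p q) with eventually-× (runs-complete p) (run-complete q)
    ... | t₀ , ev = t₀ , λ t le → let (args , res) = ev t le in begin
      if⁺ allHalted (runs t gs xs) then run t f (map pred (runs t gs xs)) else 0
        ≡⟨ cong (λ rs → if⁺ allHalted rs then run t f (map pred rs) else 0) args ⟩
      if⁺ allHalted (map suc ys) then run t f (map pred (map suc ys)) else 0
        ≡⟨ cong₂ (if⁺_then_else 0) (allHalted-suc ys) (cong (run t f) (map-pred-suc ys)) ⟩
      run t f ys
        ≡⟨ res ⟩
      _ ∎
      where open ≡-Reasoning
    run-complete (eprec0 p) = run-complete p
    run-complete (eprecS {h = h} {xs = xs} {y = y} p q) with eventually-× (run-complete p) (run-complete q)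
    ... | t₀ , ev = t₀ , λ t le → let (prev , step) = ev t le in
      trans (cong (λ a → if⁺ a then run t h (y ∷ pred a ∷ xs) else 0) prev) step
    run-complete (emu {f = f} {xs = xs} {y = y} p below)
      with eventually-× (run-complete p) (eventually-× (eventually-∀< y rejected) (eventually-≥ y))
      where
      rejected : ∀ z → z < y → Eventually (λ t → Σ ℕ λ w → run t f (z ∷ xs) ≡ 2 + w)
      rejected z lt with below z lt
      ... | w , q with run-complete q
      ...   | t₀ , ev = t₀ , λ t le → w , ev t le
    ... | t₀ , ev = t₀ , λ t le → let (at , before , y≤t) = ev t le in
      cong pred (search-finds (λ c → run t f (c ∷ xs)) y before at (suc t) (s≤s y≤t))

    runs-complete : ∀ {m n} {gs : Vec (PR n) m} {xs ys} → EvalAll O gs xs ys →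
                    Eventually (λ t → runs t gs xs ≡ map suc ys)
    runs-complete []       = 0 , λ _ _ → refl
    runs-complete (p ∷ ps) with eventually-× (run-complete p) (runs-complete ps)
    ... | t₀ , ev = t₀ , λ t le → let (hd , tl) = ev t le in cong₂ _∷_ hd tl

module CompiledInterpreter (Z O : Set2ω) (h : ℕ → ℕ) (hᶜ : Semantics.Computable Z 1 (λ ρ → h (lookup ρ zero)))
                           (Z∘h≗O : ∀ x → Z (h x) ≡ O x) where
  open Semantics Z
  open Interpreter O

  allHaltedᶜ : ∀ {n m v} → Computable* n m v → Computable n (allHalted ∘ v)
  allHaltedᶜ (es , es≗) = castᶜ (λ ρ → cong allHalted (es≗ ρ)) (go es)
    where
    go : ∀ {n m} (es : Vec (Expr n) m) → Computable n (allHalted ∘ ⟦ es ⟧*)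
    go []       = oneᶜ
    go (e ∷ es) = if⁺ᶜ (exactᶜ e) (go es) zeroᶜ

  predsᶜ : ∀ {n m v} → Computable* n m v → Computable* n m (map pred ∘ v)
  predsᶜ (es , es≗) = map (proj₁ ∘ predᶜ ∘ exactᶜ) es , λ ρ → trans (go es ρ) (cong (map pred) (es≗ ρ))
    where
    go : ∀ {n m} (es : Vec (Expr n) m) ρ → ⟦ map (proj₁ ∘ predᶜ ∘ exactᶜ) es ⟧* ρ ≡ map pred (⟦ es ⟧* ρ)
    go []       ρ = refl
    go (e ∷ es) ρ = cong₂ _∷_ (proj₂ (predᶜ (exactᶜ e)) ρ) (go es ρ)

  searchStepᶜ : ∀ {n a r c} → Computable n a → Computable n r → Computable n c →
                Computable n (λ ρ → searchStep (a ρ) (r ρ) (c ρ))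
  searchStepᶜ a r c = if⁺ᶜ a a (if⁺ᶜ r (if⁺ᶜ (predᶜ r) zeroᶜ (sucᶜ (sucᶜ c))) oneᶜ)

  mutual
    runᶜ : ∀ {n} (f : PR n) → Computable (suc n) (λ ρ → run (head ρ) f (tail ρ))
    runᶜ zer         = oneᶜ
    runᶜ succ        = castᶜ (λ { (t ∷ x ∷ []) → refl }) (sucᶜ (sucᶜ v₁ᶜ))
    runᶜ (proj i)    = castᶜ (λ { (t ∷ xs) → refl }) (sucᶜ (varᶜ (suc i)))
    runᶜ orc         = castᶜ (λ { (t ∷ x ∷ []) → cong (suc ∘ bit) (Z∘h≗O x) }) (sucᶜ (oracleᶜ (hᶜ ∘ᶜ (v₁ᶜ ∷ᶜ []ᶜ))))
    runᶜ (comp f gs) = castᶜ (λ { (t ∷ xs) → refl })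
      (if⁺ᶜ (allHaltedᶜ (runsᶜ gs)) (runᶜ f ∘ᶜ (v₀ᶜ ∷ᶜ predsᶜ (runsᶜ gs))) zeroᶜ)
    runᶜ (prec g h)  = castᶜ (λ { (t ∷ y ∷ xs) → refl })
      (recᶜ (runᶜ g ∘ᶜ (v₀ᶜ ∷ᶜ dropᶜ 2))
            (if⁺ᶜ v₁ᶜ (runᶜ h ∘ᶜ (v₂ᶜ ∷ᶜ v₀ᶜ ∷ᶜ predᶜ v₁ᶜ ∷ᶜ dropᶜ 4)) zeroᶜ)
            v₁ᶜ)
    runᶜ (mu f)      = castᶜ (λ { (t ∷ xs) → refl })
      (predᶜ (recᶜ zeroᶜ (searchStepᶜ v₁ᶜ (runᶜ f ∘ᶜ (v₂ᶜ ∷ᶜ v₀ᶜ ∷ᶜ dropᶜ 3)) v₀ᶜ) (sucᶜ v₀ᶜ)))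

    runsᶜ : ∀ {m n} (gs : Vec (PR n) m) → Computable* (suc n) m (λ ρ → runs (head ρ) gs (tail ρ))
    runsᶜ []       = []ᶜ
    runsᶜ (g ∷ gs) = runᶜ g ∷ᶜ runsᶜ gs

D-empty : ∀ i → D 0 i ≢ true
D-empty zero    ()
D-empty (suc i) e = D-empty i e

half<suc : ∀ n → half (suc n) < suc n
half<suc zero          = s≤s z≤n
half<suc (suc zero)    = s≤s (s≤s z≤n)
half<suc (suc (suc n)) = s≤s (≤-trans (half<suc n) (n≤1+n _))

D-bound : ∀ n i → D n i ≡ true → i < n
D-bound zero    i       e = ⊥-elim (D-empty i e)
D-bound (suc n) zero    _ = s≤s z≤n
D-bound (suc n) (suc i) e = ≤-trans (s≤s (D-bound (half (suc n)) i e)) (half<suc n)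

codeBelow : ℕ → Set2ω → ℕ
codeBelow zero    f = 0
codeBelow (suc N) f = bit (f 0) + (codeBelow N (f ∘ suc) + codeBelow N (f ∘ suc))

odd-bit+double : ∀ b c → odd (bit b + (c + c)) ≡ b
odd-bit+double true  zero    = refl
odd-bit+double false zero    = refl
odd-bit+double b     (suc c) rewrite +-suc c c | +-suc (bit b) (suc (c + c)) | +-suc (bit b) (c + c) = odd-bit+double b c

half-bit+double : ∀ b c → half (bit b + (c + c)) ≡ c
half-bit+double true  zero    = refl
half-bit+double false zero    = refl
half-bit+double b     (suc c) rewrite +-suc c c | +-suc (bit b) (suc (c + c)) | +-suc (bit b) (c + c) =
  cong suc (half-bit+double b c)

D-codeBelow : ∀ N f i → D (codeBelow N f) i ≡ true → i < N × f i ≡ true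
D-codeBelow zero    f i       e = ⊥-elim (D-empty i e)
D-codeBelow (suc N) f zero    e = s≤s z≤n , trans (sym (odd-bit+double (f 0) (codeBelow N (f ∘ suc)))) e
D-codeBelow (suc N) f (suc i) e
  with D-codeBelow N (f ∘ suc) i (subst (λ m → D m i ≡ true) (half-bit+double (f 0) (codeBelow N (f ∘ suc))) e)
... | i<N , fi = s≤s i<N , fi

codeBelow-D : ∀ N f i → i < N → f i ≡ true → D (codeBelow N f) i ≡ true
codeBelow-D (suc N) f zero    _   fi = trans (odd-bit+double (f 0) (codeBelow N (f ∘ suc))) fi
codeBelow-D (suc N) f (suc i) lt  fi =
  subst (λ m → D m i ≡ true) (sym (half-bit+double (f 0) (codeBelow N (f ∘ suc)))) (codeBelow-D N (f ∘ suc) i (s≤s⁻¹ lt) fi)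

codeBelow<2^ : ∀ N f → codeBelow N f < 2 ^ N
codeBelow<2^ zero    f = s≤s z≤n
codeBelow<2^ (suc N) f = bit+double< (f 0) (codeBelow<2^ N (f ∘ suc))
  where
  bit+double< : ∀ b {c p} → c < p → bit b + (c + c) < 2 * p
  bit+double< b {c} {p} c<p = begin-strict
    bit b + (c + c) ≤⟨ +-monoˡ-≤ (c + c) (bit≤1 b) ⟩
    suc (c + c)     ≡⟨ cong suc (+-comm c c) ⟩
    suc c + c       <⟨ +-mono-≤-< c<p c<p ⟩
    p + p           ≡⟨ cong (p +_) (sym (+-identityʳ p)) ⟩
    2 * p           ∎
    where
    open ≤-Reasoning
    bit≤1 : ∀ b → bit b ≤ 1
    bit≤1 true  = s≤s z≤n
    bit≤1 false = z≤n

*≢0 : ∀ a b → a ≢ 0 → b ≢ 0 → a * b ≢ 0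
*≢0 a b a≢0 b≢0 e = [ a≢0 , b≢0 ]′ (m*n≡0⇒m≡0∨n≡0 a e)

*≢0⁻¹ : ∀ a b → a * b ≢ 0 → a ≢ 0 × b ≢ 0
*≢0⁻¹ a b ab≢0 = (λ { refl → ab≢0 refl }) , (λ { refl → ab≢0 (*-zeroʳ a) })

+≢0⁻¹ : ∀ a b → a + b ≢ 0 → a ≢ 0 ⊎ b ≢ 0
+≢0⁻¹ zero    b b≢0 = inj₂ b≢0
+≢0⁻¹ (suc a) b _   = inj₁ λ ()

+≢0ˡ : ∀ a b → a ≢ 0 → a + b ≢ 0
+≢0ˡ a b a≢0 e = a≢0 (m+n≡0⇒m≡0 a e)

+≢0ʳ : ∀ a b → b ≢ 0 → a + b ≢ 0
+≢0ʳ a b b≢0 e = b≢0 (m+n≡0⇒n≡0 a e)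

bit≢0 : ∀ b → bit b ≢ 0 → b ≡ true
bit≢0 true  _    = refl
bit≢0 false b≢0  = ⊥-elim (b≢0 refl)

bit-true : ∀ {b} → b ≡ true → bit b ≢ 0
bit-true refl ()

if⁺≢0 : ∀ a b → (a ≢ 0 → b ≢ 0) → (if⁺ a then b else 1) ≢ 0
if⁺≢0 zero    b _   ()
if⁺≢0 (suc a) b imp = imp λ ()

if⁺≢0⁻¹ : ∀ a b → (if⁺ a then b else 1) ≢ 0 → a ≢ 0 → b ≢ 0
if⁺≢0⁻¹ zero    b _   a≢0 = ⊥-elim (a≢0 refl)
if⁺≢0⁻¹ (suc a) b b≢0 _   = b≢0

if⁺≡0 : ∀ a b → (if⁺ a then b else 1) ≡ 0 → a ≢ 0 × b ≡ 0
if⁺≡0 (suc a) b b≡0 = (λ ()) , b≡0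

prod<≢0 : ∀ b f → (∀ i → i < b → f i ≢ 0) → prod< b f ≢ 0
prod<≢0 zero    f _   ()
prod<≢0 (suc b) f f≢0 = *≢0 (prod< b f) (f b) (prod<≢0 b f (λ i lt → f≢0 i (m<n⇒m<1+n lt))) (f≢0 b ≤-refl)

prod<≢0⁻¹ : ∀ b f → prod< b f ≢ 0 → ∀ i → i < b → f i ≢ 0
prod<≢0⁻¹ (suc b) f p≢0 i lt with *≢0⁻¹ (prod< b f) (f b) p≢0 | m<1+n⇒m<n∨m≡n lt
... | rest , _  | inj₁ i<b  = prod<≢0⁻¹ b f rest i i<b
... | _ , last  | inj₂ refl = last

prod<≡0 : ∀ b f → prod< b f ≡ 0 → Σ ℕ λ i → i < b × f i ≡ 0
prod<≡0 (suc b) f p≡0 with m*n≡0⇒m≡0∨n≡0 (prod< b f) p≡0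
... | inj₁ rest = let (i , lt , fi) = prod<≡0 b f rest in i , m<n⇒m<1+n lt , fi
... | inj₂ last = b , ≤-refl , last

sum<≢0 : ∀ b f i → i < b → f i ≢ 0 → sum< b f ≢ 0
sum<≢0 (suc b) f i lt fi≢0 with m<1+n⇒m<n∨m≡n lt
... | inj₁ i<b  = +≢0ˡ (sum< b f) (f b) (sum<≢0 b f i i<b fi≢0)
... | inj₂ refl = +≢0ʳ (sum< b f) (f b) fi≢0

sum<≢0⁻¹ : ∀ b f → sum< b f ≢ 0 → Σ ℕ λ i → i < b × f i ≢ 0
sum<≢0⁻¹ zero    f s≢0 = ⊥-elim (s≢0 refl)
sum<≢0⁻¹ (suc b) f s≢0 with +≢0⁻¹ (sum< b f) (f b) s≢0
... | inj₁ rest = let (i , lt , fi) = sum<≢0⁻¹ b f rest in i , m<n⇒m<1+n lt , fi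
... | inj₂ last = b , ≤-refl , last

-- Predicates on canonical codes are decided by functions whose nonzero values mean true.
subsetℕ : ℕ → ℕ → ℕ
subsetℕ m p = prod< m (λ i → if⁺ bit (D m i) then bit (D p i) else 1)

subsetℕ-sound : ∀ m p → subsetℕ m p ≢ 0 → D m ⊆ D p
subsetℕ-sound m p s≢0 i i∈m =
  bit≢0 _ (if⁺≢0⁻¹ _ _ (prod<≢0⁻¹ m _ s≢0 i (D-bound m i i∈m)) (bit-true i∈m))

subsetℕ-complete : ∀ m p → D m ⊆ D p → subsetℕ m p ≢ 0
subsetℕ-complete m p m⊆p = prod<≢0 m _ λ i _ → if⁺≢0 _ _ λ i∈m → bit-true (m⊆p i (bit≢0 _ i∈m))

Covered : ℕ → Set2ω → Set2ω → Set
Covered n P Q = ∀ i → D n i ≡ true → P i ≡ true ⊎ Q i ≡ true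

coverℕ : ℕ → ℕ → ℕ → ℕ
coverℕ n p q = prod< n (λ i → if⁺ bit (D n i) then bit (D p i) + bit (D q i) else 1)

coverℕ-sound : ∀ n p q → coverℕ n p q ≢ 0 → Covered n (D p) (D q)
coverℕ-sound n p q c≢0 i i∈n =
  ⊎-map (bit≢0 _) (bit≢0 _)
    (+≢0⁻¹ _ _ (if⁺≢0⁻¹ _ _ (prod<≢0⁻¹ n _ c≢0 i (D-bound n i i∈n)) (bit-true i∈n)))

coverℕ-complete : ∀ n p q → Covered n (D p) (D q) → coverℕ n p q ≢ 0
coverℕ-complete n p q cov = prod<≢0 n _ λ i _ → if⁺≢0 _ _ λ i∈n →
  [ (λ i∈p → +≢0ˡ _ _ (bit-true i∈p)) , (λ i∈q → +≢0ʳ (bit (D p i)) _ (bit-true i∈q)) ]′ (cov i (bit≢0 _ i∈n))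

InStage : (ℕ → ℕ → ℕ) → ℕ → Set2ω → Set
InStage r t P = Σ ℕ λ s → Σ ℕ λ m → s ≤ t × m ≤ t × r s m ≢ 0 × D m ⊆ P

inStageℕ : (ℕ → ℕ → ℕ) → ℕ → ℕ → ℕ
inStageℕ r t p = sum< (suc t) λ s → sum< (suc t) λ m → r s m * subsetℕ m p

inStageℕ-sound : ∀ r t p → inStageℕ r t p ≢ 0 → InStage r t (D p)
inStageℕ-sound r t p x≢0 with sum<≢0⁻¹ (suc t) _ x≢0
... | s , s<t , y≢0 with sum<≢0⁻¹ (suc t) _ y≢0
... | m , m<t , z≢0 with *≢0⁻¹ (r s m) (subsetℕ m p) z≢0
... | rsm≢0 , sub≢0 = s , m , s≤s⁻¹ s<t , s≤s⁻¹ m<t , rsm≢0 , subsetℕ-sound m p sub≢0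

inStageℕ-complete : ∀ r t p → InStage r t (D p) → inStageℕ r t p ≢ 0
inStageℕ-complete r t p (s , m , s≤t , m≤t , rsm≢0 , m⊆p) =
  sum<≢0 (suc t) _ s (s≤s s≤t) (sum<≢0 (suc t) _ m (s≤s m≤t) (*≢0 _ _ rsm≢0 (subsetℕ-complete m p m⊆p)))

splitsℕ : (ℕ → ℕ → ℕ) → (ℕ → ℕ → ℕ) → ℕ → ℕ → ℕ
splitsℕ r₀ r₁ t n = prod< (2 ^ n) λ p → prod< (2 ^ n) λ q →
  if⁺ coverℕ n p q then inStageℕ r₀ t p + inStageℕ r₁ t q else 1

splitsℕ-sound : ∀ r₀ r₁ t n → splitsℕ r₀ r₁ t n ≢ 0 → ∀ p q → p < 2 ^ n → q < 2 ^ n →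
                Covered n (D p) (D q) → InStage r₀ t (D p) ⊎ InStage r₁ t (D q)
splitsℕ-sound r₀ r₁ t n x≢0 p q p< q< cov =
  ⊎-map (inStageℕ-sound r₀ t p) (inStageℕ-sound r₁ t q)
    (+≢0⁻¹ _ _ (if⁺≢0⁻¹ _ _ (prod<≢0⁻¹ (2 ^ n) _ (prod<≢0⁻¹ (2 ^ n) _ x≢0 p p<) q q<) (coverℕ-complete n p q cov)))

splitsℕ≡0 : ∀ r₀ r₁ t n → splitsℕ r₀ r₁ t n ≡ 0 → Σ ℕ λ p → Σ ℕ λ q →
            Covered n (D p) (D q) × ¬ InStage r₀ t (D p) × ¬ InStage r₁ t (D q)
splitsℕ≡0 r₀ r₁ t n x≡0 with prod<≡0 (2 ^ n) _ x≡0
... | p , _ , y≡0 with prod<≡0 (2 ^ n) _ y≡0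
... | q , _ , z≡0 with if⁺≡0 _ _ z≡0
... | c≢0 , w≡0 =
  p , q , coverℕ-sound n p q c≢0 ,
  (λ in₀ → inStageℕ-complete r₀ t p in₀ (m+n≡0⇒m≡0 _ w≡0)) ,
  (λ in₁ → inStageℕ-complete r₁ t q in₁ (m+n≡0⇒n≡0 (inStageℕ r₀ t p) w≡0))

-- König's lemma

Node : Set
Node = Set2ω × Set2ω

AgreeBelow : ℕ → Node → Node → Set
AgreeBelow N (σ , τ) (σ′ , τ′) = ∀ i → i < N → σ i ≡ σ′ i × τ i ≡ τ′ i

_[_≔_] : Set2ω → ℕ → Bool → Set2ω
(σ [ N ≔ b ]) i with i ≟ N
... | yes _ = b
... | no  _ = σ i

[≔]-below : ∀ σ N b i → i < N → (σ [ N ≔ b ]) i ≡ σ i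
[≔]-below σ N b i i<N with i ≟ N
... | yes refl = ⊥-elim (<-irrefl refl i<N)
... | no  _    = refl

[≔]-at : ∀ σ N b → (σ [ N ≔ b ]) N ≡ b
[≔]-at σ N b with N ≟ N
... | yes _  = refl
... | no N≢N = ⊥-elim (N≢N refl)

child : Node → ℕ → Bool × Bool → Node
child (σ , τ) N (b , c) = σ [ N ≔ b ] , τ [ N ≔ c ]

module Compactness (em : ExcludedMiddle 0ℓ) (Good : ℕ → Node → Set)
  (good-mono   : ∀ {N M} nd → N ≤ M → Good M nd → Good N nd)
  (good-local  : ∀ {N} nd nd′ → AgreeBelow N nd nd′ → Good N nd → Good N nd′)
  (good-exists : ∀ N → Σ Node (Good N)) where

  Extendible : ℕ → Node → Set
  Extendible N nd = ∀ M → N ≤ M → Σ Node λ nd′ → AgreeBelow N nd nd′ × Good M nd′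

  child-agrees : ∀ N nd nd′ → AgreeBelow N nd nd′ →
                 AgreeBelow (suc N) (child nd N (proj₁ nd′ N , proj₂ nd′ N)) nd′
  child-agrees N (σ , τ) (σ′ , τ′) agree i lt with m<1+n⇒m<n∨m≡n lt
  ... | inj₁ i<N  = trans ([≔]-below σ N _ i i<N) (proj₁ (agree i i<N)) ,
                    trans ([≔]-below τ N _ i i<N) (proj₂ (agree i i<N))
  ... | inj₂ refl = [≔]-at σ N _ , [≔]-at τ N _

  not-extendible : ∀ N nd → ¬ Extendible N nd →
                   Σ ℕ λ M → N ≤ M × ¬ (Σ Node λ nd′ → AgreeBelow N nd nd′ × Good M nd′)
  not-extendible N nd ¬ext = em⇒dne em λ ¬bound →
    ¬ext λ M N≤M → em⇒dne em λ ¬good → ¬bound (M , N≤M , ¬good)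

  extendible-child : ∀ N nd → Extendible N nd → Σ (Bool × Bool) λ bc → Extendible (suc N) (child nd N bc)
  extendible-child N nd ext with em {Σ (Bool × Bool) λ bc → Extendible (suc N) (child nd N bc)}
  ... | yes found = found
  ... | no  none  = ⊥-elim (bound-refuted (ext M N≤M))
    where
    dead : ∀ bc → Σ ℕ λ M → suc N ≤ M × ¬ (Σ Node λ nd′ → AgreeBelow (suc N) (child nd N bc) nd′ × Good M nd′)
    dead bc = not-extendible (suc N) (child nd N bc) (λ e → none (bc , e))
    M : ℕ
    M = (proj₁ (dead (true , true)) ⊔ proj₁ (dead (true , false))) ⊔
        (proj₁ (dead (false , true)) ⊔ proj₁ (dead (false , false)))
    M-bound : ∀ bc → proj₁ (dead bc) ≤ M
    M-bound (true  , true)  = ≤-trans (m≤m⊔n _ _) (m≤m⊔n _ _)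
    M-bound (true  , false) = ≤-trans (m≤n⊔m (proj₁ (dead (true , true))) _) (m≤m⊔n _ _)
    M-bound (false , true)  = ≤-trans (m≤m⊔n _ _) (m≤n⊔m (proj₁ (dead (true , true)) ⊔ proj₁ (dead (true , false))) _)
    M-bound (false , false) = ≤-trans (m≤n⊔m (proj₁ (dead (false , true))) _)
                                      (m≤n⊔m (proj₁ (dead (true , true)) ⊔ proj₁ (dead (true , false))) _)
    N≤M : N ≤ M
    N≤M = ≤-trans (n≤1+n N) (≤-trans (proj₁ (proj₂ (dead (true , true)))) (M-bound (true , true)))
    bound-refuted : ¬ (Σ Node λ nd′ → AgreeBelow N nd nd′ × Good M nd′)
    bound-refuted (nd′ , agree , good) =
      proj₂ (proj₂ (dead bc)) (nd′ , child-agrees N nd nd′ agree , good-mono nd′ (M-bound bc) good)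
      where bc = proj₁ nd′ N , proj₂ nd′ N

  branch : ∀ N → Σ Node (Extendible N)
  branch zero    = ((λ _ → false) , (λ _ → false)) , λ M _ → proj₁ (good-exists M) , (λ _ ()) , proj₂ (good-exists M)
  branch (suc N) with branch N
  ... | nd , ext with extendible-child N nd ext
  ... | bc , ext′ = child nd N bc , ext′

  node : ℕ → Node
  node N = proj₁ (branch N)

  node-step : ∀ N → AgreeBelow N (node N) (node (suc N))
  node-step N i lt with branch N
  ... | (σ , τ) , ext with extendible-child N (σ , τ) ext
  ... | (b , c) , _ = sym ([≔]-below σ N b i lt) , sym ([≔]-below τ N c i lt)

  node-stable : ∀ N d → AgreeBelow N (node N) (node (d + N))
  node-stable N zero    i lt = refl , refl
  node-stable N (suc d) i lt with node-stable N d i lt | node-step (d + N) i (≤-trans lt (m≤n+m N d))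
  ... | a₁ , a₂ | b₁ , b₂ = trans a₁ b₁ , trans a₂ b₂

  limit : Node
  limit = (λ i → proj₁ (node (suc i)) i) , (λ i → proj₂ (node (suc i)) i)

  node-limit : ∀ N → AgreeBelow N (node N) limit
  node-limit N i lt with m≤n⇒∃[o]m+o≡n lt
  ... | d , refl with node-stable (suc i) d i ≤-refl
  ... | a₁ , a₂ = sym (subst (λ K → proj₁ (node (suc i)) i ≡ proj₁ (node K) i) (+-comm d (suc i)) a₁) ,
                  sym (subst (λ K → proj₂ (node (suc i)) i ≡ proj₂ (node K) i) (+-comm d (suc i)) a₂)

  compactness : Σ Node λ nd → ∀ N → Good N nd
  compactness = limit , λ N → let (nd′ , agree , good) = proj₂ (branch N) N ≤-refl in
    good-local nd′ limit (λ i lt → trans (sym (proj₁ (agree i lt))) (proj₁ (node-limit N i lt)) ,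
                                    trans (sym (proj₂ (agree i lt))) (proj₂ (node-limit N i lt))) good

-- The nonsplitting class

U-mono : ∀ Z e {Y Y′} → U Z e Y → Y ⊆ Y′ → U Z e Y′
U-mono Z e (n , w , n⊆Y) Y⊆Y′ = n , w , λ i i∈n → Y⊆Y′ i (n⊆Y i i∈n)

InStage-mono : ∀ r {t t′ P} → t ≤ t′ → InStage r t P → InStage r t′ P
InStage-mono r t≤t′ (s , m , s≤t , m≤t , rsm≢0 , m⊆P) = s , m , ≤-trans s≤t t≤t′ , ≤-trans m≤t t≤t′ , rsm≢0 , m⊆P

InStage-local : ∀ r {t P P′} → (∀ i → i < t → P′ i ≡ P i) → InStage r t P′ → InStage r t P
InStage-local r P′≗P (s , m , s≤t , m≤t , rsm≢0 , m⊆P′) =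
  s , m , s≤t , m≤t , rsm≢0 , λ i i∈m → trans (sym (P′≗P i (<-≤-trans (D-bound m i i∈m) m≤t))) (m⊆P′ i i∈m)

module _ (O : Set2ω) where
  open Interpreter O

  stage : PR 1 → ℕ → ℕ → ℕ
  stage e s m = run s e (m ∷ [])

  InStage⇒U : ∀ e {t P} → InStage (stage e) t P → U O e P
  InStage⇒U e (s , m , _ , _ , rsm≢0 , m⊆P) with stage e s m in halted
  ... | zero  = ⊥-elim (rsm≢0 refl)
  ... | suc v = m , (v , run-sound e s (m ∷ []) v halted) , m⊆P

  U⇒InStage : ∀ e {P} → U O e P → Eventually (λ t → InStage (stage e) t P)
  U⇒InStage e (m , (v , ev) , m⊆P) with eventually-× (run-complete ev) (eventually-≥ m)
  ... | t₀ , halts = t₀ , λ t le → let (halted , m≤t) = halts t le in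
    t , m , ≤-refl , m≤t , (λ e≡0 → 0≢1+n (trans (sym e≡0) halted)) , m⊆P

FirstZero : (ℕ → ℕ) → Set
FirstZero g = Σ ℕ λ m → g m ≡ 0 × (∀ z → z < m → Σ ℕ λ w → g z ≡ suc w)

scan : ∀ g b → FirstZero g ⊎ (∀ z → z < b → Σ ℕ λ w → g z ≡ suc w)
scan g zero = inj₂ λ _ ()
scan g (suc b) with scan g b
... | inj₁ first = inj₁ first
... | inj₂ below with g b in gb
...   | zero  = inj₁ (b , gb , below)
...   | suc w = inj₂ λ z lt → [ below z , (λ { refl → w , gb }) ]′ (m<1+n⇒m<n∨m≡n lt)

first-zero : ∀ g t → g t ≡ 0 → FirstZero g
first-zero g t gt≡0 with scan g (suc t)
... | inj₁ first = first
... | inj₂ below with below t ≤-refl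
...   | w , gt≡suc = ⊥-elim (0≢1+n (trans (sym gt≡0) gt≡suc))

module SearchProgram (Z : Set2ω) where
  open Semantics Z

  searchProgram : ∀ {g} → Computable 2 g → PR 1
  searchProgram (e , _) = mu (compile e)

  W-searchProgram⇒ : ∀ {g} (gᶜ : Computable 2 g) n → W Z (searchProgram gᶜ) n → Σ ℕ λ y → g (y ∷ n ∷ []) ≡ 0
  W-searchProgram⇒ (e , e≗g) n (y , emu zero-at _) =
    y , trans (sym (e≗g _)) (sym (Eval-functional zero-at (compile-correct e _)))

  W-searchProgram⇐ : ∀ {g} (gᶜ : Computable 2 g) n y → g (y ∷ n ∷ []) ≡ 0 → W Z (searchProgram gᶜ) n
  W-searchProgram⇐ (e , e≗g) n y gy≡0 with first-zero (λ z → ⟦ e ⟧ (z ∷ n ∷ [])) y (trans (e≗g _) gy≡0)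
  ... | m , at , below = m , emu (evaluates at) (λ z lt → proj₁ (below z lt) , evaluates (proj₂ (below z lt)))
    where
    evaluates : ∀ {z v} → ⟦ e ⟧ (z ∷ n ∷ []) ≡ v → Eval Z (compile e) (z ∷ n ∷ []) v
    evaluates eq = subst (Eval Z (compile e) _) eq (compile-correct e _)

  zeroTest : PR 1
  zeroTest = searchProgram (if⁺ᶜ (oddᶜ v₁ᶜ) zeroᶜ oneᶜ)

  U-zeroTest⇒ : ∀ {Y} → U Z zeroTest Y → Y 0 ≡ true
  U-zeroTest⇒ (n , w , n⊆Y) with W-searchProgram⇒ (if⁺ᶜ (oddᶜ v₁ᶜ) zeroᶜ oneᶜ) n w
  ... | _ , test≡0 = n⊆Y 0 (odd-test test≡0)
    where
    odd-test : (if⁺ bit (odd n) then 0 else 1) ≡ 0 → odd n ≡ true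
    odd-test test≡0 with odd n
    ... | true = refl

  U-zeroTest⇐ : ∀ {Y} → Y 0 ≡ true → U Z zeroTest Y
  U-zeroTest⇐ {Y} Y0 = 1 , W-searchProgram⇐ (if⁺ᶜ (oddᶜ v₁ᶜ) zeroᶜ oneᶜ) 1 0 refl , D1⊆Y
    where
    D1⊆Y : D 1 ⊆ Y
    D1⊆Y zero    _ = Y0
    D1⊆Y (suc i) e = ⊥-elim (D-empty i e)

module ComputablePredicates (Z : Set2ω) where
  open Semantics Z

  subsetᶜ : ∀ {n m p} → Computable n m → Computable n p → Computable n (λ ρ → subsetℕ (m ρ) (p ρ))
  subsetᶜ m p = prodᶜ m (if⁺ᶜ (memberᶜ v₀ᶜ (m ∘ᶜ dropᶜ 1)) (memberᶜ v₀ᶜ (p ∘ᶜ dropᶜ 1)) oneᶜ)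

  coverᶜ : ∀ {n k p q} → Computable n k → Computable n p → Computable n q →
           Computable n (λ ρ → coverℕ (k ρ) (p ρ) (q ρ))
  coverᶜ k p q =
    prodᶜ k (if⁺ᶜ (memberᶜ v₀ᶜ (k ∘ᶜ dropᶜ 1)) (memberᶜ v₀ᶜ (p ∘ᶜ dropᶜ 1) +ᶜ memberᶜ v₀ᶜ (q ∘ᶜ dropᶜ 1)) oneᶜ)

  inStageᶜ : ∀ {n r t p} → Computable 2 (λ ρ → r (lookup ρ zero) (lookup ρ (suc zero))) →
             Computable n t → Computable n p → Computable n (λ ρ → inStageℕ r (t ρ) (p ρ))
  inStageᶜ r t p =
    sumᶜ (sucᶜ t) (sumᶜ (sucᶜ (t ∘ᶜ dropᶜ 1)) ((r ∘ᶜ (v₁ᶜ ∷ᶜ v₀ᶜ ∷ᶜ []ᶜ)) *ᶜ subsetᶜ v₀ᶜ (p ∘ᶜ dropᶜ 2)))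

  splitsᶜ : ∀ {r₀ r₁} → Computable 2 (λ ρ → r₀ (lookup ρ zero) (lookup ρ (suc zero))) →
            Computable 2 (λ ρ → r₁ (lookup ρ zero) (lookup ρ (suc zero))) →
            Computable 2 (λ ρ → splitsℕ r₀ r₁ (lookup ρ zero) (lookup ρ (suc zero)))
  splitsᶜ {r₀} {r₁} r₀ᶜ r₁ᶜ = prodᶜ (pow2ᶜ v₁ᶜ) (prodᶜ (pow2ᶜ v₂ᶜ)
    (if⁺ᶜ (coverᶜ v₃ᶜ v₁ᶜ v₀ᶜ) (inStageᶜ {r = r₀} r₀ᶜ v₂ᶜ v₁ᶜ +ᶜ inStageᶜ {r = r₁} r₁ᶜ v₂ᶜ v₀ᶜ) oneᶜ))

⊕-even : ∀ (P Q : Set2ω) n → (P ⊕ Q) (n + n) ≡ P n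
⊕-even P Q zero    = refl
⊕-even P Q (suc n) = trans (cong (P ⊕ Q) (cong suc (+-suc n n))) (⊕-even (P ∘ suc) (Q ∘ suc) n)

⊕-odd : ∀ (P Q : Set2ω) n → (P ⊕ Q) (suc (n + n)) ≡ Q n
⊕-odd P Q zero    = refl
⊕-odd P Q (suc n) = trans (cong (P ⊕ Q) (cong (λ k → suc (suc k)) (+-suc n n))) (⊕-odd (P ∘ suc) (Q ∘ suc) n)

_⊆_∪_ : Set2ω → Set2ω → Set2ω → Set
S ⊆ Y₀ ∪ Y₁ = ∀ n → S n ≡ true → Y₀ n ≡ true ⊎ Y₁ n ≡ true

SplitsAvoiding : Class → Class → Set2ω → Set
SplitsAvoiding A₀ A₁ S = Σ Set2ω λ Y₀ → Σ Set2ω λ Y₁ → S ⊆ Y₀ ∪ Y₁ × ¬ A₀ Y₀ × ¬ A₁ Y₁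

-- program searches for n and a stage t such that every splitting of D n into D p ∪ D q has D p in
-- stage t of U^{O₀}_{e₀} or D q in stage t of U^{O₁}_{e₁}.
module NonsplittingClass (em : ExcludedMiddle 0ℓ) (Z O₀ O₁ : Set2ω) (Z≐O₀⊕O₁ : Z ≐ (O₀ ⊕ O₁))
                         (e₀ e₁ : PR 1) where
  open Semantics Z
  open SearchProgram Z
  open ComputablePredicates Z

  r₀ r₁ : ℕ → ℕ → ℕ
  r₀ = stage O₀ e₀
  r₁ = stage O₁ e₁

  -- Abstract, since type checking must never normalise the compiled program.
  abstract
    r₀ᶜ : Computable 2 (λ ρ → r₀ (lookup ρ zero) (lookup ρ (suc zero)))
    r₀ᶜ = castᶜ (λ { (s ∷ m ∷ []) → refl })
            (CompiledInterpreter.runᶜ Z O₀ (λ x → x + x) (v₀ᶜ +ᶜ v₀ᶜ)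
              (λ x → trans (Z≐O₀⊕O₁ (x + x)) (⊕-even O₀ O₁ x)) e₀)

    r₁ᶜ : Computable 2 (λ ρ → r₁ (lookup ρ zero) (lookup ρ (suc zero)))
    r₁ᶜ = castᶜ (λ { (s ∷ m ∷ []) → refl })
            (CompiledInterpreter.runᶜ Z O₁ (λ x → suc (x + x)) (sucᶜ (v₀ᶜ +ᶜ v₀ᶜ))
              (λ x → trans (Z≐O₀⊕O₁ (suc (x + x))) (⊕-odd O₀ O₁ x)) e₁)

    splitsTestᶜ : Computable 2 (λ ρ → if⁺ splitsℕ r₀ r₁ (lookup ρ zero) (lookup ρ (suc zero)) then 0 else 1)
    splitsTestᶜ = if⁺ᶜ (splitsᶜ {r₀ = r₀} {r₁} r₀ᶜ r₁ᶜ) zeroᶜ oneᶜ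

    program : PR 1
    program = searchProgram splitsTestᶜ

    W-program⇒ : ∀ n → W Z program n → Σ ℕ λ t → splitsℕ r₀ r₁ t n ≢ 0
    W-program⇒ n w with W-searchProgram⇒ splitsTestᶜ n w
    ... | t , test≡0 = t , λ splits≡0 → 0≢1+n (trans (sym test≡0) (cong (if⁺_then 0 else 1) splits≡0))

    W-program⇐ : ∀ n t → splitsℕ r₀ r₁ t n ≢ 0 → W Z program n
    W-program⇐ n t splits≢0 =
      W-searchProgram⇐ splitsTestᶜ n t (test≡0 _ splits≢0)
      where
      test≡0 : ∀ x → x ≢ 0 → (if⁺ x then 0 else 1) ≡ 0
      test≡0 zero    x≢0 = ⊥-elim (x≢0 refl)
      test≡0 (suc x) _   = refl

  codeBelow⊆ : ∀ N f → D (codeBelow N f) ⊆ f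
  codeBelow⊆ N f i = proj₂ ∘ D-codeBelow N f i

  program-sound : ∀ S → U Z program S → ¬ SplitsAvoiding (U O₀ e₀) (U O₁ e₁) S
  program-sound S (n , w , n⊆S) (Y₀ , Y₁ , S⊆Y₀∪Y₁ , ¬U₀ , ¬U₁) with W-program⇒ n w
  ... | t , splits≢0 with splitsℕ-sound r₀ r₁ t n splits≢0 p₀ p₁ (codeBelow<2^ n Y₀) (codeBelow<2^ n Y₁) covered
    where
    p₀ p₁ : ℕ
    p₀ = codeBelow n Y₀
    p₁ = codeBelow n Y₁
    covered : Covered n (D p₀) (D p₁)
    covered i i∈n = ⊎-map (codeBelow-D n Y₀ i (D-bound n i i∈n)) (codeBelow-D n Y₁ i (D-bound n i i∈n))
                                 (S⊆Y₀∪Y₁ i (n⊆S i i∈n))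
  ... | inj₁ in₀ = ¬U₀ (U-mono O₀ e₀ (InStage⇒U O₀ e₀ in₀) (codeBelow⊆ n Y₀))
  ... | inj₂ in₁ = ¬U₁ (U-mono O₁ e₁ (InStage⇒U O₁ e₁ in₁) (codeBelow⊆ n Y₁))

  Good : Set2ω → ℕ → Node → Set
  Good S N (Y₀ , Y₁) = (∀ i → i < N → S i ≡ true → Y₀ i ≡ true ⊎ Y₁ i ≡ true) ×
                       ¬ InStage r₀ N Y₀ × ¬ InStage r₁ N Y₁

  good-mono : ∀ S {N M} nd → N ≤ M → Good S M nd → Good S N nd
  good-mono S nd N≤M (covers , ¬in₀ , ¬in₁) =
    (λ i i<N → covers i (<-≤-trans i<N N≤M)) , ¬in₀ ∘ InStage-mono r₀ N≤M , ¬in₁ ∘ InStage-mono r₁ N≤M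

  good-local : ∀ S {N} nd nd′ → AgreeBelow N nd nd′ → Good S N nd → Good S N nd′
  good-local S nd nd′ agree (covers , ¬in₀ , ¬in₁) =
    (λ i i<N i∈S → ⊎-map (trans (sym (proj₁ (agree i i<N)))) (trans (sym (proj₂ (agree i i<N))))
                                (covers i i<N i∈S)) ,
    ¬in₀ ∘ InStage-local r₀ (λ i i<N → sym (proj₁ (agree i i<N))) ,
    ¬in₁ ∘ InStage-local r₁ (λ i i<N → sym (proj₂ (agree i i<N)))

  good-exists : ∀ S → ¬ U Z program S → ∀ N → Σ Node (Good S N)
  good-exists S ¬U N with splitsℕ r₀ r₁ N (codeBelow N S) ≟ 0
  ... | no splits≢0 = ⊥-elim (¬U (codeBelow N S , W-program⇐ (codeBelow N S) N splits≢0 , codeBelow⊆ N S))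
  ... | yes splits≡0 with splitsℕ≡0 r₀ r₁ N (codeBelow N S) splits≡0
  ... | p₀ , p₁ , covered , ¬in₀ , ¬in₁ =
    (D p₀ , D p₁) , (λ i i<N i∈S → covered i (codeBelow-D N S i i<N i∈S)) , ¬in₀ , ¬in₁

  program-complete : ∀ S → ¬ U Z program S → SplitsAvoiding (U O₀ e₀) (U O₁ e₁) S
  program-complete S ¬U with Compactness.compactness em (Good S) (good-mono S) (good-local S) (good-exists S ¬U)
  ... | (Y₀ , Y₁) , good = Y₀ , Y₁ , (λ i → proj₁ (good (suc i)) i ≤-refl) , avoids₀ , avoids₁
    where
    avoids₀ : ¬ U O₀ e₀ Y₀
    avoids₀ u = let (t₀ , in₀) = U⇒InStage O₀ e₀ u in proj₁ (proj₂ (good t₀)) (in₀ t₀ ≤-refl)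
    avoids₁ : ¬ U O₁ e₁ Y₁
    avoids₁ u = let (t₀ , in₁) = U⇒InStage O₁ e₁ u in proj₂ (proj₂ (good t₀)) (in₁ t₀ ≤-refl)

-- Partition regularity

⋃ : ∀ {k} → (Fin k → Set2ω) → Set2ω
⋃ {zero}  Ys n = false
⋃ {suc k} Ys n = Ys zero n ∨ ⋃ (Ys ∘ suc) n

⋃-intro : ∀ {k} (Ys : Fin k → Set2ω) j n → Ys j n ≡ true → ⋃ Ys n ≡ true
⋃-intro Ys zero    n e rewrite e = refl
⋃-intro Ys (suc j) n e rewrite ⋃-intro (Ys ∘ suc) j n e = ∨-zeroʳ (Ys zero n)

⋃-elim : ∀ {k} (Ys : Fin k → Set2ω) n → ⋃ Ys n ≡ true → Σ (Fin k) λ j → Ys j n ≡ true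
⋃-elim {suc k} Ys n e with Ys zero n in eq
... | true  = zero , eq
... | false = let (j , e′) = ⋃-elim (Ys ∘ suc) n e in suc j , e′

largeness-∩ : ExcludedMiddle 0ℓ → ∀ {A V : Class} → IsLargeness A → (∀ Y Y′ → V Y → Y ⊆ Y′ → V Y′) →
              (∀ S → ¬ V S → SplitsAvoiding A A S) → IsLargeness (λ Y → A Y × V Y)
largeness-∩ em {A} {V} (_ , A-mono , A-large) V-mono V-splits =
  nonempty , (λ Y Y′ (a , v) Y⊆Y′ → A-mono Y Y′ a Y⊆Y′ , V-mono Y Y′ v Y⊆Y′) , large
  where
  large : ∀ k (Ys : Fin k → Set2ω) → Covers Ys ω → Σ (Fin k) λ j → A (Ys j) × V (Ys j)
  large k Ys cover with em {Σ (Fin k) λ j → A (Ys j) × V (Ys j)}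
  ... | yes found = found
  ... | no  none  = ⊥-elim (avoided (A-large (k + k) pieces′ covered))
    where
    split : ∀ j → SplitsAvoiding A A (Ys j)
    split j with em {A (Ys j)}
    ... | yes a = V-splits (Ys j) (λ v → none (j , a , v))
    ... | no ¬a = Ys j , Ys j , (λ n → inj₁) , ¬a , ¬a
    pieces : Fin k ⊎ Fin k → Set2ω
    pieces (inj₁ j) = proj₁ (split j)
    pieces (inj₂ j) = proj₁ (proj₂ (split j))
    pieces′ : Fin (k + k) → Set2ω
    pieces′ = pieces ∘ splitAt k
    covered : Covers pieces′ ω
    covered n _ with cover n refl
    ... | j , n∈Ys with proj₁ (proj₂ (proj₂ (split j))) n n∈Ys
    ... | inj₁ n∈Y₀ = join k k (inj₁ j) , subst (λ s → pieces s n ≡ true) (sym (splitAt-join k k (inj₁ j))) n∈Y₀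
    ... | inj₂ n∈Y₁ = join k k (inj₂ j) , subst (λ s → pieces s n ≡ true) (sym (splitAt-join k k (inj₂ j))) n∈Y₁
    avoided : ¬ (Σ (Fin (k + k)) λ i → A (pieces′ i))
    avoided (i , a) with splitAt k i
    ... | inj₁ j = proj₁ (proj₂ (proj₂ (proj₂ (split j)))) a
    ... | inj₂ j = proj₂ (proj₂ (proj₂ (proj₂ (split j)))) a
  nonempty : Σ Set2ω λ Y → A Y × V Y
  nonempty with large 1 (λ _ → ω) (λ n _ → zero , refl)
  ... | zero , av = ω , av

module PartitionRegularity (em : ExcludedMiddle 0ℓ) (X : ℕ → Set2ω) (scott : IsScottSet X)
                           (C : PR 1 → ℕ → Set) (large : IsLargeness (UMC X C))
                           (minimal : IsMinimal X (UMC X C)) where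
  open SearchProgram (X 0) using (zeroTest; U-zeroTest⇒; U-zeroTest⇐)

  A : Class
  A = UMC X C

  A-mono : ∀ Y Y′ → A Y → Y ⊆ Y′ → A Y′
  A-mono = proj₁ (proj₂ large)

  ∉A : ∀ Y → ¬ A Y → Σ (PR 1) λ e → Σ ℕ λ i → C e i × ¬ U (X i) e Y
  ∉A Y ¬a = em⇒dne em λ none → ¬a λ e i c → em⇒dne em λ ¬u → none (e , i , c , ¬u)

  module Nonsplitting {e₀ i₀ e₁ i₁} (c₀ : C e₀ i₀) (c₁ : C e₁ i₁) where
    c : ℕ
    c = proj₁ (proj₁ (proj₂ scott) i₀ i₁)

    open NonsplittingClass em (X c) (X i₀) (X i₁) (proj₂ (proj₁ (proj₂ scott) i₀ i₁)) e₀ e₁ public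

    outside-splits : ∀ S → ¬ U (X c) program S → SplitsAvoiding A A S
    outside-splits S ¬V with program-complete S ¬V
    ... | Y₀ , Y₁ , S⊆Y₀∪Y₁ , ¬U₀ , ¬U₁ = Y₀ , Y₁ , S⊆Y₀∪Y₁ , (λ a → ¬U₀ (a e₀ i₀ c₀)) , (λ a → ¬U₁ (a e₁ i₁ c₁))

    A⊆program : ∀ S → A S → U (X c) program S
    A⊆program S a with minimal c program
    ... | inj₁ A⊆V    = A⊆V S a
    ... | inj₂ ¬large = ⊥-elim (¬large (largeness-∩ em large (λ Y Y′ → U-mono (X c) program) outside-splits))

  members-unsplittable : ∀ S → A S → ¬ SplitsAvoiding A A S
  members-unsplittable S a (Y₀ , Y₁ , S⊆Y₀∪Y₁ , ¬a₀ , ¬a₁) with ∉A Y₀ ¬a₀ | ∉A Y₁ ¬a₁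
  ... | e₀ , i₀ , c₀ , ¬U₀ | e₁ , i₁ , c₁ , ¬U₁ =
    Nonsplitting.program-sound c₀ c₁ S (Nonsplitting.A⊆program c₀ c₁ S a) (Y₀ , Y₁ , S⊆Y₀∪Y₁ , ¬U₀ , ¬U₁)

  two-regular : ∀ S Y₀ Y₁ → A S → S ⊆ Y₀ ∪ Y₁ → A Y₀ ⊎ A Y₁
  two-regular S Y₀ Y₁ a S⊆Y₀∪Y₁ with em {A Y₀} | em {A Y₁}
  ... | yes a₀ | _      = inj₁ a₀
  ... | no _   | yes a₁ = inj₂ a₁
  ... | no ¬a₀ | no ¬a₁ = ⊥-elim (members-unsplittable S a (Y₀ , Y₁ , S⊆Y₀∪Y₁ , ¬a₀ , ¬a₁))

  members-nonempty : ∀ S → A S → Σ ℕ λ n → S n ≡ true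
  members-nonempty S a with minimal 0 zeroTest
  ... | inj₁ A⊆U = 0 , U-zeroTest⇒ (A⊆U S a)
  ... | inj₂ ¬large with em {Σ ℕ λ n → S n ≡ true}
  ... | yes nonempty = nonempty
  ... | no empty = ⊥-elim (¬large ((ω , all ω , U-zeroTest⇐ refl) ,
                                   (λ Y Y′ (_ , u) Y⊆Y′ → all Y′ , U-mono (X 0) zeroTest u Y⊆Y′) ,
                                   λ k Ys cover → let (j , e) = cover 0 refl in j , all (Ys j) , U-zeroTest⇐ e))
    where
    all : ∀ Y → A Y
    all Y = A-mono S Y a λ n e → ⊥-elim (empty (n , e))

  regular : ∀ k S (Ys : Fin k → Set2ω) → A S → Covers Ys S → Σ (Fin k) λ j → A (Ys j)
  regular zero S Ys a cover with members-nonempty S a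
  ... | n , n∈S with cover n n∈S
  ... | () , _
  regular (suc k) S Ys a cover with two-regular S (Ys zero) (⋃ (Ys ∘ suc)) a first-or-rest
    where
    first-or-rest : S ⊆ Ys zero ∪ ⋃ (Ys ∘ suc)
    first-or-rest n n∈S with cover n n∈S
    ... | zero  , n∈Y = inj₁ n∈Y
    ... | suc j , n∈Y = inj₂ (⋃-intro (Ys ∘ suc) j n n∈Y)
  ... | inj₁ a₀   = zero , a₀
  ... | inj₂ aRest = let (j , aj) = regular k (⋃ (Ys ∘ suc)) (Ys ∘ suc) aRest (⋃-elim (Ys ∘ suc)) in suc j , aj

corollary2p13 : ExcludedMiddle 0ℓ →
    (X : ℕ → Set2ω) → IsScottSet X →
    (C : PR 1 → ℕ → Set) →
    IsLargeness (UMC X C) → IsMinimal X (UMC X C) →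
    IsPartitionRegular (UMC X C)
corollary2p13 em X scott C large minimal = large , λ S a k Ys cover → regular k S Ys a cover
  where open PartitionRegularity em X scott C large minimal
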